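{- Let $m$ be a positive integer and let $A=\{a_s(n_s)\}_{s=1}^k$ (with $a_s\in\mathbb{Z}$, $n_s$ positive integers, $a_s(n_s)=a_s+n_s\mathbb{Z}$) form an $m$-cover of $\mathbb{Z}$. Let $m_1,\ldots,m_k$ be any integers and set $$S(A)=\Big\{\Big\{\sum_{s\in I}\frac{m_s}{n_s}\Big\}:\ I\subseteq\{1,\ldots,k\}\Big\}.$$ Then $|S(A)|\le 2^{k-m}$.
   Context: A finite system $\{a_s(n_s)\}_{s=1}^k$ is an $m$-cover of $\mathbb{Z}$ if every integer lies in at least $m$ of the sets $a_s+n_s\mathbb{Z}$ (counted with multiplicity over $s$). $\{\alpha\}$ denotes the fractional part of a real number $\alpha$. -}

module Defs where

open import Data.Nat using (ℕ; zero; suc; NonZero)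
open import Data.Bool using (Bool; true; false; if_then_else_)
open import Data.Fin using (Fin)
open import Data.Fin.Subset using (Subset)
open import Data.Vec using (Vec; []; _∷_; lookup)
open import Data.List using (List; []; _∷_; map; _++_; length; filter; deduplicate; allFin)
open import Data.Integer using (ℤ; +_; _-_)
open import Data.Integer.Divisibility.Signed using (_∣_; _∣?_)
open import Data.Rational as ℚ using (ℚ; 0ℚ; floor; _/_)

-- Fractional part {q} = q - ⌊q⌋ (in [0,1); note stdlib's fracPart uses
-- truncation and absolute value, which differs for negatives).
frac : ℚ → ℚ
frac q = q ℚ.- (floor q / 1)

coverCount : (k : ℕ) → (Fin k → ℤ) → (Fin k → ℕ) → ℤ → ℕ
coverCount k a n x = length (filter (λ s → (+ n s) ∣? (x - a s)) (allFin k))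

IsMCover : (m k : ℕ) → (Fin k → ℤ) → (Fin k → ℕ) → Set
IsMCover m k a n = ∀ (x : ℤ) → m Data.Nat.≤ coverCount k a n x

allSubsets : (k : ℕ) → List (Subset k)
allSubsets zero = [] ∷ []
allSubsets (suc k) = map (true ∷_) (allSubsets k) ++ map (false ∷_) (allSubsets k)

sumℚ : (k : ℕ) → (Fin k → ℚ) → ℚ
sumℚ k f = Data.List.foldr ℚ._+_ 0ℚ (map f (allFin k))

subsetSum : (k : ℕ) (n : Fin k → ℕ) (pos : ∀ s → NonZero (n s)) (m : Fin k → ℤ) →
            Subset k → ℚ
subsetSum k n pos m I =
  sumℚ k (λ s → if lookup I s then _/_ (m s) (n s) {{pos s}} else 0ℚ)

SA : (k : ℕ) (n : Fin k → ℕ) (pos : ∀ s → NonZero (n s)) (m : Fin k → ℤ) → List ℚ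
SA k n pos m = deduplicate ℚ._≟_ (map (λ I → frac (subsetSum k n pos m I)) (allSubsets k))

-- Put N = ∏ nₛ and Cₛ = mₛ·N/nₛ, so that Σ_{s∈I} mₛ/nₛ = w(I)/N with w(I) = Σ_{s∈I} Cₛ; its
-- fractional part depends only on w(I) mod N.  It therefore suffices to show that for every J at
-- least 2^m subsets I satisfy w(I) ≡ w(J) (mod N): each of the |S(A)| values is then taken by at
-- least 2^m of the 2^k subsets.
--
-- This bound is proved by induction on m, for the subsystem indexed by any R ⊆ {1,…,k} that
-- covers every integer m times.  The key step is that a covering R contains a nonempty I with
-- N ∣ w(I).  For each x the alternating sum Σ_{I⊆R} (-1)^∣I∣ G(x·w(I) - Σ_{s∈I} Cₛaₛ) vanishes,
-- because toggling an index s with x ∈ aₛ(nₛ) changes the argument by a multiple of N.  Summing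
-- over x < N kills every I with N ∤ w(I), while I = ∅ contributes N·G(0) ≠ 0, so some nonempty
-- I with N ∣ w(I) must contribute as well.  Here G is an integer-valued stand-in for the
-- Ramanujan sum y ↦ Σ ζ^y over the primitive N-th roots of unity, built prime by prime.
-- Applied with the signs of C flipped on J, the key step yields I ≠ J in the class of J; an
-- index s at which I and J differ splits the subsets of R by membership of s into two families,
-- each bounded by the induction hypothesis for R ∖ {s}, which covers every integer m - 1 times.

module Submission where

open import Defs
open import Data.Nat using (ℕ; NonZero; _≤_; _^_; _∸_)
open import Data.Fin using (Fin)
open import Data.Integer using (ℤ)
open import Data.List using (length)

open import Data.Bool using (true; false; if_then_else_; _xor_; _∧_)
open import Data.Fin using (zero; suc)
open import Data.Fin.Subset using (Subset; Side; inside; outside; _∈_; _∉_; _⊆_; Nonempty; ⊥; ⊤; _∩_; ∣_∣)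
open import Data.Fin.Subset.Properties using (drop-∷-⊆; out⊆; s⊆s; x∈p∩q⁻; _∈?_; ∩-identityˡ; ⊆⊤)
open import Data.Integer as ℤ using (+_; 0ℤ; 1ℤ; -_; _+_; _-_; _*_)
import Data.Integer.Coprimality as ℤ
open import Data.Integer.Divisibility.Signed as ℤ using (divides; _∣?_; ∣⇒∣ᵤ; ∣ᵤ⇒∣)
import Data.Integer.DivMod as ℤ
import Data.Integer.Properties as ℤ
open import Data.Integer.Tactic.RingSolver using (solve-∀)
open import Data.List using (List; []; _∷_; filter; map; _++_)
import Data.List as List
import Data.List.Membership.Propositional as List
open import Data.List.Membership.Propositional.Properties using (∈-tabulate⁺; ∈-map⁻; ∈-deduplicate⁻)
import Data.List.Properties as List
open import Data.List.Relation.Unary.All using (All; []; _∷_)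
import Data.List.Relation.Unary.All as All
open import Data.List.Relation.Unary.All.Properties using (tabulate⁺)
open import Data.List.Relation.Unary.AllPairs using ([]; _∷_)
import Data.List.Relation.Unary.Any as Any
open import Data.List.Relation.Unary.Unique.Propositional using (Unique)
open import Data.Nat as ℕ using (zero; suc; _<_; z≤n; s≤s)
open import Data.Nat.Coprimality using (Coprime; coprime-Bézout)
import Data.Nat.Divisibility as ℕ
import Data.Nat.DivMod as ℕ
open import Data.Nat.GCD using (module Bézout)
open import Data.Nat.ListAction using (product)
open import Data.Nat.ListAction.Properties using (∈⇒∣product; product≢0)
open import Data.Nat.Primality using (Prime; prime⇒irreducible; prime⇒nonZero; prime⇒nonTrivial; euclidsLemma)
open import Data.Nat.Primality.Factorisation using (factorise; PrimeFactorisation)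
import Data.Nat.Properties as ℕ
import Data.Nat.Tactic.RingSolver as ℕ-Solver
open import Algebra.Properties.CommutativeSemigroup ℕ.+-commutativeSemigroup using (interchange)
open import Data.Product using (∃; _×_; _,_; proj₁; proj₂)
open import Data.Rational as ℚ using (ℚ; mkℚ; 0ℚ; floor; _/_; toℚᵘ)
import Data.Rational.Properties as ℚ
open import Data.Rational.Solver using (module +-*-Solver)
open import Data.Rational.Unnormalised as ℚᵘ using (mkℚᵘ; *≡*) renaming (_≃_ to _≃ᵘ_)
import Data.Rational.Unnormalised.Properties as ℚᵘ
open import Data.List.Relation.Unary.Unique.DecPropositional.Properties ℚ._≟_ using (deduplicate-!)
open import Data.Sum using (_⊎_; inj₁; inj₂; [_,_]′)
open import Data.Vec using ([]; _∷_; here; there; lookup; tabulate; zipWith; _[_]≔_)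
import Data.Vec.Properties as Vec
open import Function using (_∘_)
open import Relation.Binary.Definitions using (DecidableEquality)
open import Relation.Binary.PropositionalEquality
open import Relation.Nullary using (¬_; yes; no; does; ¬?; contradiction)
open import Relation.Nullary.Decidable using (decidable-stable)
open import Relation.Unary using (Decidable)

sumTo : ℕ → (ℕ → ℤ) → ℤ
sumTo zero    f = 0ℤ
sumTo (suc n) f = sumTo n f + f n

syntax sumTo n (λ x → e) = ∑[ x < n ] e

∑-cong : ∀ n {f g : ℕ → ℤ} → (∀ x → x < n → f x ≡ g x) → sumTo n f ≡ sumTo n g
∑-cong zero    f≗g = refl
∑-cong (suc n) f≗g =
  cong₂ _+_ (∑-cong n (λ x x<n → f≗g x (ℕ.m<n⇒m<1+n x<n))) (f≗g n ℕ.≤-refl)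

∑-const : ∀ n c → ∑[ x < n ] c ≡ + n * c
∑-const zero    c = sym (ℤ.*-zeroˡ c)
∑-const (suc n) c = begin
  ∑[ x < n ] c + c  ≡⟨ cong (_+ c) (∑-const n c) ⟩
  + n * c + c       ≡⟨ ring (+ n) c ⟩
  (1ℤ + + n) * c    ≡⟨ cong (_* c) (ℤ.pos-+ 1 n) ⟨
  + suc n * c       ∎
  where
  open ≡-Reasoning
  ring : ∀ m c → m * c + c ≡ (1ℤ + m) * c
  ring = solve-∀

∑-zero : ∀ n {f : ℕ → ℤ} → (∀ x → x < n → f x ≡ 0ℤ) → sumTo n f ≡ 0ℤ
∑-zero n f≗0 = trans (∑-cong n f≗0) (trans (∑-const n 0ℤ) (ℤ.*-zeroʳ (+ n)))

∑-distrib-- : ∀ n (f g : ℕ → ℤ) → ∑[ x < n ] (f x - g x) ≡ sumTo n f - sumTo n g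
∑-distrib-- zero    f g = refl
∑-distrib-- (suc n) f g = trans (cong (_+ (f n - g n)) (∑-distrib-- n f g))
                                (ring (sumTo n f) (sumTo n g) (f n) (g n))
  where
  ring : ∀ a b c d → (a - b) + (c - d) ≡ (a + c) - (b + d)
  ring = solve-∀

∑-distribˡ-* : ∀ n c (f : ℕ → ℤ) → ∑[ x < n ] (c * f x) ≡ c * sumTo n f
∑-distribˡ-* zero    c f = sym (ℤ.*-zeroʳ c)
∑-distribˡ-* (suc n) c f = trans (cong (_+ c * f n) (∑-distribˡ-* n c f))
                                 (sym (ℤ.*-distribˡ-+ c (sumTo n f) (f n)))

∑-split-+ : ∀ a b (f : ℕ → ℤ) → sumTo (a ℕ.+ b) f ≡ sumTo a f + ∑[ r < b ] f (a ℕ.+ r)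
∑-split-+ a zero    f rewrite ℕ.+-identityʳ a = sym (ℤ.+-identityʳ (sumTo a f))
∑-split-+ a (suc b) f rewrite ℕ.+-suc a b | ∑-split-+ a b f = ℤ.+-assoc (sumTo a f) _ _

∑-split-* : ∀ a b (f : ℕ → ℤ) → ∑[ x < a ℕ.* b ] f x ≡ ∑[ t < a ] ∑[ r < b ] f (t ℕ.* b ℕ.+ r)
∑-split-* zero    b f = refl
∑-split-* (suc a) b f rewrite ℕ.+-comm b (a ℕ.* b) | ∑-split-+ (a ℕ.* b) b f | ∑-split-* a b f = refl

∑-periodic : ∀ a b (f : ℕ → ℤ) → (∀ x → f (x ℕ.+ b) ≡ f x) → ∑[ x < a ℕ.* b ] f x ≡ + a * sumTo b f
∑-periodic a b f f-periodic = begin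
  ∑[ x < a ℕ.* b ] f x                   ≡⟨ ∑-split-* a b f ⟩
  ∑[ t < a ] ∑[ r < b ] f (t ℕ.* b ℕ.+ r) ≡⟨ ∑-cong a (λ t _ → ∑-cong b (λ r _ → shift t r)) ⟩
  ∑[ t < a ] sumTo b f                   ≡⟨ ∑-const a (sumTo b f) ⟩
  + a * sumTo b f                        ∎
  where
  open ≡-Reasoning
  shift : ∀ t r → f (t ℕ.* b ℕ.+ r) ≡ f r
  shift zero    r = refl
  shift (suc t) r = begin
    f (b ℕ.+ t ℕ.* b ℕ.+ r) ≡⟨ cong f (ring b t r) ⟩
    f (t ℕ.* b ℕ.+ r ℕ.+ b) ≡⟨ f-periodic (t ℕ.* b ℕ.+ r) ⟩
    f (t ℕ.* b ℕ.+ r)       ≡⟨ shift t r ⟩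
    f r                     ∎
    where
    ring : ∀ b t r → b ℕ.+ t ℕ.* b ℕ.+ r ≡ t ℕ.* b ℕ.+ r ℕ.+ b
    ring = ℕ-Solver.solve-∀

∑-single : ∀ n {f : ℕ → ℤ} r₀ → r₀ < n → (∀ r → r < n → r ≢ r₀ → f r ≡ 0ℤ) → sumTo n f ≡ f r₀
∑-single (suc n) {f} r₀ r₀<1+n f≡0 with r₀ ℕ.≟ n
... | yes refl = trans (cong (_+ f n) (∑-zero n (λ r r<n → f≡0 r (ℕ.m<n⇒m<1+n r<n) (ℕ.<⇒≢ r<n))))
                       (ℤ.+-identityˡ (f n))
... | no  r₀≢n = trans (cong₂ _+_ (∑-single n r₀ (ℕ.≤∧≢⇒< (ℕ.≤-pred r₀<1+n) r₀≢n)
                                              (λ r r<n → f≡0 r (ℕ.m<n⇒m<1+n r<n)))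
                                  (f≡0 n ℕ.≤-refl (r₀≢n ∘ sym)))
                       (ℤ.+-identityʳ (f r₀))

m∣n∧n<m⇒n≡0 : ∀ {m n} → m ℕ.∣ n → n < m → n ≡ 0
m∣n∧n<m⇒n≡0 {n = zero}  _   _   = refl
m∣n∧n<m⇒n≡0 {n = suc n} m∣n n<m = contradiction (ℕ.∣⇒≤ m∣n) (ℕ.<⇒≱ n<m)

residue-injective : ∀ {d r r′} → r < d → r′ < d → + d ℤ.∣ + r - + r′ → r ≡ r′
residue-injective {d} {r} {r′} r<d r′<d d∣r-r′ =
  ℤ.+-injective (ℤ.i-j≡0⇒i≡j (+ r) (+ r′)
    (ℤ.∣i∣≡0⇒i≡0 (m∣n∧n<m⇒n≡0 (∣⇒∣ᵤ d∣r-r′) ∣r-r′∣<d)))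
  where
  ∣r-r′∣<d : ℤ.∣ + r - + r′ ∣ < d
  ∣r-r′∣<d = subst (_< d) (cong ℤ.∣_∣ (sym (ℤ.m-n≡m⊖n r r′)))
                   (ℕ.≤-<-trans (ℤ.∣m⊝n∣≤m⊔n r r′) (ℕ.⊔-lub r<d r′<d))

module _ {p : ℕ} (p-prime : Prime p) where

  private instance
    p≢0 : NonZero p
    p≢0 = prime⇒nonZero p-prime

  euclidsLemmaℤ : ∀ i j → + p ℤ.∣ i * j → + p ℤ.∣ i ⊎ + p ℤ.∣ j
  euclidsLemmaℤ i j p∣ij
    with euclidsLemma ℤ.∣ i ∣ ℤ.∣ j ∣ p-prime (subst (p ℕ.∣_) (ℤ.abs-* i j) (∣⇒∣ᵤ p∣ij))
  ... | inj₁ p∣i = inj₁ (∣ᵤ⇒∣ p∣i)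
  ... | inj₂ p∣j = inj₂ (∣ᵤ⇒∣ p∣j)

  ∤⇒coprime : ∀ {n} → ¬ (p ℕ.∣ n) → Coprime n p
  ∤⇒coprime p∤n (d∣n , d∣p) with prime⇒irreducible p-prime d∣p
  ... | inj₁ d≡1 = d≡1
  ... | inj₂ refl = contradiction d∣n p∤n

  private
    lift-Bézout : ∀ a b c d → 1 ℕ.+ a ℕ.* b ≡ c ℕ.* d → 1ℤ + + a * + b ≡ + c * + d
    lift-Bézout a b c d eq = begin
      1ℤ + + a * + b     ≡⟨ cong (λ u → 1ℤ + u) (ℤ.pos-* a b) ⟨
      + (1 ℕ.+ a ℕ.* b)  ≡⟨ cong +_ eq ⟩
      + (c ℕ.* d)        ≡⟨ ℤ.pos-* c d ⟩
      + c * + d          ∎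
      where open ≡-Reasoning

    ∃-inverse-ℕ : ∀ {n} → ¬ (p ℕ.∣ n) → ∃ λ w → + p ℤ.∣ w * + n - 1ℤ
    ∃-inverse-ℕ {n} p∤n with coprime-Bézout (∤⇒coprime p∤n)
    ... | Bézout.+- x y 1+yp≡xn = + x , divides (+ y)
      (trans (cong (_- 1ℤ) (sym (lift-Bézout y p x n 1+yp≡xn))) (ring (+ y * + p)))
      where
      ring : ∀ u → 1ℤ + u - 1ℤ ≡ u
      ring = solve-∀
    ... | Bézout.-+ x y 1+xn≡yp = - + x , divides (- + y)
      (trans (ring (+ x) (+ n)) (trans (cong -_ (lift-Bézout x n y p 1+xn≡yp)) (ℤ.neg-distribˡ-* (+ y) (+ p))))
      where
      ring : ∀ x n → - x * n - 1ℤ ≡ - (1ℤ + x * n)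
      ring = solve-∀

  ∃-inverse : ∀ {θ} → ¬ (+ p ℤ.∣ θ) → ∃ λ w → + p ℤ.∣ w * θ - 1ℤ
  ∃-inverse {θ} p∤θ with ∃-inverse-ℕ (p∤θ ∘ ∣ᵤ⇒∣) | ℤ.+∣i∣≡i⊎+∣i∣≡-i θ
  ... | w , p∣w∣θ∣-1 | inj₁ ∣θ∣≡θ  = w , subst (λ t → + p ℤ.∣ w * t - 1ℤ) ∣θ∣≡θ p∣w∣θ∣-1
  ... | w , p∣w∣θ∣-1 | inj₂ ∣θ∣≡-θ =
    - w , subst (λ t → + p ℤ.∣ t - 1ℤ) (trans (cong (w *_) ∣θ∣≡-θ) (ring w θ)) p∣w∣θ∣-1
    where
    ring : ∀ w θ → w * - θ ≡ - w * θ
    ring = solve-∀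

  linear-root-unique : ∀ {θ c r r′} → ¬ (+ p ℤ.∣ θ) → r < p → r′ < p →
                       + p ℤ.∣ + r * θ + c → + p ℤ.∣ + r′ * θ + c → r ≡ r′
  linear-root-unique {θ} {c} {r} {r′} p∤θ r<p r′<p p∣rθ+c p∣r′θ+c
    with euclidsLemmaℤ (+ r - + r′) θ p∣[r-r′]θ
    where
    ring : ∀ r r′ θ c → (r * θ + c) - (r′ * θ + c) ≡ (r - r′) * θ
    ring = solve-∀
    p∣[r-r′]θ : + p ℤ.∣ (+ r - + r′) * θ
    p∣[r-r′]θ = subst (+ p ℤ.∣_) (ring (+ r) (+ r′) θ c) (ℤ.∣m∣n⇒∣m-n p∣rθ+c p∣r′θ+c)
  ... | inj₁ p∣r-r′ = residue-injective r<p r′<p p∣r-r′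
  ... | inj₂ p∣θ    = contradiction p∣θ p∤θ

  ∃-linear-root : ∀ {θ} c → ¬ (+ p ℤ.∣ θ) → ∃ λ r → r < p × + p ℤ.∣ + r * θ + c
  ∃-linear-root {θ} c p∤θ with ∃-inverse p∤θ
  ... | w , p∣wθ-1 = r , ℤ.n%ℕd<d a p , subst (+ p ℤ.∣_) (ring (+ r) c w θ)
                       (ℤ.∣m∣n⇒∣m+n (ℤ.∣m⇒∣m*n θ p∣r-a) (ℤ.∣n⇒∣m*n (- c) p∣wθ-1))
    where
    a = - c * w
    r = a ℤ.%ℕ p
    p∣r-a : + p ℤ.∣ + r - a
    p∣r-a = divides (- (a ℤ./ℕ p)) (begin
      + r - a                          ≡⟨ cong (λ u → + r - u) (ℤ.a≡a%ℕn+[a/ℕn]*n a p) ⟩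
      + r - (+ r + a ℤ./ℕ p * + p)     ≡⟨ cancel (+ r) (a ℤ./ℕ p) (+ p) ⟩
      - (a ℤ./ℕ p) * + p               ∎)
      where
      open ≡-Reasoning
      cancel : ∀ r q p → r - (r + q * p) ≡ - q * p
      cancel = solve-∀
    ring : ∀ r c w θ → (r - - c * w) * θ + - c * (w * θ - 1ℤ) ≡ r * θ + c
    ring = solve-∀

toℚᵘ-/ : ∀ i d .{{_ : NonZero d}} → toℚᵘ (i / d) ≃ᵘ mkℚᵘ i (ℕ.pred d)
toℚᵘ-/ i (suc d) = ℚ.toℚᵘ-fromℚᵘ (mkℚᵘ i d)

/-+-/ : ∀ i j d .{{_ : NonZero d}} → i / d ℚ.+ j / d ≡ (i + j) / d
/-+-/ i j d@(suc d-1) = ℚ.toℚᵘ-injective (begin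
  toℚᵘ (i / d ℚ.+ j / d)              ≈⟨ ℚ.toℚᵘ-homo-+ (i / d) (j / d) ⟩
  toℚᵘ (i / d) ℚᵘ.+ toℚᵘ (j / d)     ≈⟨ ℚᵘ.+-cong (toℚᵘ-/ i d) (toℚᵘ-/ j d) ⟩
  mkℚᵘ i d-1 ℚᵘ.+ mkℚᵘ j d-1          ≈⟨ *≡* (trans (ring i j (+ d)) (cong ((i + j) *_) (sym (ℤ.pos-* d d)))) ⟩
  mkℚᵘ (i + j) d-1                    ≈⟨ toℚᵘ-/ (i + j) d ⟨
  toℚᵘ ((i + j) / d)                  ∎)
  where
  open ℚᵘ.≃-Reasoning
  ring : ∀ i j d → (i * d + j * d) * d ≡ (i + j) * (d * d)
  ring = solve-∀

/-cong-* : ∀ i {n N} q .{{_ : NonZero n}} .{{_ : NonZero N}} → N ≡ q ℕ.* n → i / n ≡ (i * + q) / N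
/-cong-* i {n@(suc _)} {N@(suc _)} q N≡qn = ℚ.toℚᵘ-injective (begin
  toℚᵘ (i / n)         ≈⟨ toℚᵘ-/ i n ⟩
  mkℚᵘ i (ℕ.pred n)    ≈⟨ *≡* (trans (cong (λ u → i * + u) N≡qn)
                                  (trans (cong (i *_) (ℤ.pos-* q n)) (sym (ℤ.*-assoc i (+ q) (+ n))))) ⟩
  mkℚᵘ (i * + q) (ℕ.pred N) ≈⟨ toℚᵘ-/ (i * + q) N ⟨
  toℚᵘ ((i * + q) / N) ∎)
  where open ℚᵘ.≃-Reasoning

/-shift : ∀ j z N .{{_ : NonZero N}} → (j + z * + N) / N ≡ j / N ℚ.+ z / 1
/-shift j z N = sym (trans (cong (j / N ℚ.+_) (/-cong-* z N (sym (ℕ.*-identityʳ N)))) (/-+-/ j (z * + N) N))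

/ℕ-unique : ∀ a d q r .{{_ : NonZero d}} → a ≡ + r + q * + d → r < d → a ℤ./ℕ d ≡ q
/ℕ-unique a d q r a≡r+qd r<d =
  ℤ.i-j≡0⇒i≡j q′ q (ℤ.*-cancelʳ-≡ (q′ - q) 0ℤ (+ d) (trans (sym key) r-r′≡0))
  where
  q′ = a ℤ./ℕ d
  r′ = a ℤ.%ℕ d
  key : + r - + r′ ≡ (q′ - q) * + d
  key = begin
    + r - + r′                                       ≡⟨ ring (+ r) (+ r′) q q′ (+ d) ⟩
    (+ r + q * + d) - (+ r′ + q′ * + d) + (q′ - q) * + d
      ≡⟨ cong₂ (λ u v → u - v + (q′ - q) * + d) a≡r+qd (ℤ.a≡a%ℕn+[a/ℕn]*n a d) ⟨
    a - a + (q′ - q) * + d                           ≡⟨ cong (_+ (q′ - q) * + d) (ℤ.+-inverseʳ a) ⟩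
    0ℤ + (q′ - q) * + d                              ≡⟨ ℤ.+-identityˡ _ ⟩
    (q′ - q) * + d                                   ∎
    where
    open ≡-Reasoning
    ring : ∀ r r′ q q′ d → r - r′ ≡ (r + q * d) - (r′ + q′ * d) + (q′ - q) * d
    ring = solve-∀
  r-r′≡0 : + r - + r′ ≡ 0ℤ
  r-r′≡0 rewrite residue-injective r<d (ℤ.n%ℕd<d a d) (divides (q′ - q) key) = ℤ.+-inverseʳ (+ r′)

/ℕ-+-* : ∀ a z d .{{_ : NonZero d}} → (a + z * + d) ℤ./ℕ d ≡ a ℤ./ℕ d + z
/ℕ-+-* a z d = /ℕ-unique (a + z * + d) d (a ℤ./ℕ d + z) (a ℤ.%ℕ d)
  (trans (cong (_+ z * + d) (ℤ.a≡a%ℕn+[a/ℕn]*n a d)) (ring (+ (a ℤ.%ℕ d)) (a ℤ./ℕ d) z (+ d)))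
  (ℤ.n%ℕd<d a d)
  where
  ring : ∀ r q z d → r + q * d + z * d ≡ r + (q + z) * d
  ring = solve-∀

coprime-+-* : ∀ a z {d} → Coprime ℤ.∣ a ∣ d → Coprime ℤ.∣ a + z * + d ∣ d
coprime-+-* a z {d} a⊥d {i} (i∣a+zd , i∣d) =
  a⊥d (∣⇒∣ᵤ {+ i} {a} (ℤ.∣m+n∣n⇒∣m (∣ᵤ⇒∣ {+ i} i∣a+zd) (ℤ.∣n⇒∣m*n z (∣ᵤ⇒∣ {+ i} {+ d} i∣d)))
      , i∣d)

floor-+ℤ : ∀ q z → floor (q ℚ.+ z / 1) ≡ floor q + z
floor-+ℤ q@(mkℚ a d-1 a⊥d) z = begin
  floor (q ℚ.+ z / 1)        ≡⟨ cong floor q+z≡ ⟩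
  (a + z * + d) ℤ./ + d      ≡⟨ ℤ.div-pos-is-/ℕ (a + z * + d) d ⟩
  (a + z * + d) ℤ./ℕ d       ≡⟨ /ℕ-+-* a z d ⟩
  a ℤ./ℕ d + z               ≡⟨ cong (_+ z) (ℤ.div-pos-is-/ℕ a d) ⟨
  floor q + z                ∎
  where
  open ≡-Reasoning
  d = suc d-1
  q+z≡ : q ℚ.+ z / 1 ≡ mkℚ (a + z * + d) d-1 (coprime-+-* a z a⊥d)
  q+z≡ = ℚ.toℚᵘ-injective (ℚᵘ.≃-trans (ℚ.toℚᵘ-homo-+ q (z / 1))
           (ℚᵘ.≃-trans (ℚᵘ.+-cong (ℚᵘ.≃-refl {mkℚᵘ a d-1}) (toℚᵘ-/ z 1))
             (*≡* (trans (ring a z (+ d)) (cong (λ u → (a + z * + d) * + u) (sym (ℕ.*-identityʳ d)))))))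
    where
    ring : ∀ a z d → (a * 1ℤ + z * d) * d ≡ (a + z * d) * d
    ring = solve-∀

frac-+ℤ : ∀ q z → frac (q ℚ.+ z / 1) ≡ frac q
frac-+ℤ q z = begin
  (q ℚ.+ z / 1) ℚ.- floor (q ℚ.+ z / 1) / 1     ≡⟨ cong (λ f → (q ℚ.+ z / 1) ℚ.- f / 1) (floor-+ℤ q z) ⟩
  (q ℚ.+ z / 1) ℚ.- (floor q + z) / 1           ≡⟨ cong (λ f → (q ℚ.+ z / 1) ℚ.- f) (/-+-/ (floor q) z 1) ⟨
  (q ℚ.+ z / 1) ℚ.- (floor q / 1 ℚ.+ z / 1)
    ≡⟨ solve 3 (λ q z f → (q :+ z) :- (f :+ z) := q :- f) refl q (z / 1) (floor q / 1) ⟩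
  q ℚ.- floor q / 1                              ∎
  where
  open ≡-Reasoning
  open +-*-Solver

frac-/-cong : ∀ {i j} N .{{_ : NonZero N}} → + N ℤ.∣ i - j → frac (i / N) ≡ frac (j / N)
frac-/-cong {i} {j} N (divides z i-j≡zN) = begin
  frac (i / N)                 ≡⟨ cong (λ u → frac (u / N)) i≡j+zN ⟩
  frac ((j + z * + N) / N)     ≡⟨ cong frac (/-shift j z N) ⟩
  frac (j / N ℚ.+ z / 1)       ≡⟨ frac-+ℤ (j / N) z ⟩
  frac (j / N)                 ∎
  where
  open ≡-Reasoning
  i≡j+zN : i ≡ j + z * + N
  i≡j+zN = trans (ring i j) (cong (λ u → j + u) i-j≡zN)
    where
    ring : ∀ i j → i ≡ j + (i - j)
    ring = solve-∀

record RamanujanKernel (N : ℕ) (G : ℤ → ℤ) : Set where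
  field
    periodic     : ∀ y z → G (y + z * + N) ≡ G y
    nonzero-at-0 : G 0ℤ ≢ 0ℤ
    ∑-vanishes   : ∀ θ c → ¬ (+ N ℤ.∣ θ) → ∑[ x < N ] G (+ x * θ + c) ≡ 0ℤ

module KernelProperties {N G} (K : RamanujanKernel N G) where
  open RamanujanKernel K

  ∣⇒G-invariant : ∀ y {z} → + N ℤ.∣ z → G (y + z) ≡ G y
  ∣⇒G-invariant y (divides q refl) = periodic y q

  ∑-multiple : ∀ M {θ} c → + N ℤ.∣ θ → ∑[ x < M ] G (+ x * θ + c) ≡ + M * G c
  ∑-multiple M {θ} c N∣θ = trans (∑-cong M (λ x _ → trans (cong G (ℤ.+-comm (+ x * θ) c))
                                                         (∣⇒G-invariant c (ℤ.∣n⇒∣m*n (+ x) N∣θ))))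
                                 (∑-const M (G c))

  ∑-progression : ∀ a θ c → ∑[ x < a ℕ.* N ] G (+ x * θ + c) ≡ + a * ∑[ x < N ] G (+ x * θ + c)
  ∑-progression a θ c = ∑-periodic a N _ (λ x → trans (cong G (step x)) (periodic _ θ))
    where
    step : ∀ x → + (x ℕ.+ N) * θ + c ≡ (+ x * θ + c) + θ * + N
    step x = trans (cong (λ u → u * θ + c) (ℤ.pos-+ x N)) (ring (+ x) (+ N) θ c)
      where
      ring : ∀ x n θ c → (x + n) * θ + c ≡ (x * θ + c) + θ * n
      ring = solve-∀

module _ {p} (p-prime : Prime p) where

  ∑-sift : ∀ M {θ c r₀} (f : ℤ → ℤ) → ¬ (+ p ℤ.∣ θ) → r₀ < p → + p ℤ.∣ + r₀ * θ + c →
           (∀ y → ¬ (+ p ℤ.∣ y) → f y ≡ 0ℤ) →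
           ∑[ x < p ℕ.* M ] f (+ x * θ + c) ≡ ∑[ t < M ] f (+ t * (+ p * θ) + (+ r₀ * θ + c))
  ∑-sift M {θ} {c} {r₀} f p∤θ r₀<p r₀-root f-off = begin
    ∑[ x < p ℕ.* M ] f (+ x * θ + c)                   ≡⟨ cong (λ n → ∑[ x < n ] f (+ x * θ + c)) (ℕ.*-comm p M) ⟩
    ∑[ x < M ℕ.* p ] f (+ x * θ + c)                   ≡⟨ ∑-split-* M p _ ⟩
    ∑[ t < M ] ∑[ r < p ] f (+ (t ℕ.* p ℕ.+ r) * θ + c) ≡⟨ ∑-cong M (λ t _ → single t) ⟩
    ∑[ t < M ] f (+ t * (+ p * θ) + (+ r₀ * θ + c))     ∎
    where
    open ≡-Reasoning
    split : ∀ t r → + (t ℕ.* p ℕ.+ r) * θ + c ≡ + t * (+ p * θ) + (+ r * θ + c)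
    split t r = trans (cong (λ u → u * θ + c) (trans (ℤ.pos-+ (t ℕ.* p) r) (cong (_+ + r) (ℤ.pos-* t p))))
                      (ring (+ t) (+ p) (+ r) θ c)
      where
      ring : ∀ t p r θ c → (t * p + r) * θ + c ≡ t * (p * θ) + (r * θ + c)
      ring = solve-∀
    p∣t[pθ] : ∀ t → + p ℤ.∣ + t * (+ p * θ)
    p∣t[pθ] t = ℤ.∣n⇒∣m*n (+ t) (ℤ.∣m⇒∣m*n θ ℤ.∣-refl)
    single : ∀ t → ∑[ r < p ] f (+ (t ℕ.* p ℕ.+ r) * θ + c) ≡ f (+ t * (+ p * θ) + (+ r₀ * θ + c))
    single t = trans (∑-single p r₀ r₀<p off) (cong f (split t r₀))
      where
      off : ∀ r → r < p → r ≢ r₀ → f (+ (t ℕ.* p ℕ.+ r) * θ + c) ≡ 0ℤ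
      off r r<p r≢r₀ = f-off _ λ p∣ → r≢r₀ (linear-root-unique p-prime p∤θ r<p r₀<p
                         (ℤ.∣m+n∣m⇒∣n (subst (+ p ℤ.∣_) (split t r) p∣) (p∣t[pθ] t)) r₀-root)

unit-kernel : RamanujanKernel 1 (λ _ → 1ℤ)
unit-kernel = record
  { periodic     = λ _ _ → refl
  ; nonzero-at-0 = λ ()
  ; ∑-vanishes   = λ θ _ 1∤θ → contradiction (divides θ (sym (ℤ.*-identityʳ θ))) 1∤θ
  }

-- The Ramanujan sums satisfy c_{pN}(y) = p·[p ∣ y]·c_N(y/p) if p ∣ N, and
-- c_{pN}(y) = (p·[p ∣ y] - 1)·c_N(y) if p ∤ N; dilate drops the harmless factor p.
dilate : ℕ → (ℤ → ℤ) → ℤ → ℤ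
dilate p G y with + p ∣? y
... | yes p∣y = G (ℤ.quotient p∣y)
... | no  _   = 0ℤ

sieve : ℕ → ℤ → ℤ
sieve p y with + p ∣? y
... | yes _ = + p
... | no  _ = 0ℤ

twist : ℕ → (ℤ → ℤ) → ℤ → ℤ
twist p G y = sieve p y * G y - G y

module _ {p} .{{_ : NonZero p}} where

  dilate-* : ∀ G q → dilate p G (q * + p) ≡ G q
  dilate-* G q with + p ∣? (q * + p)
  ... | yes (divides q′ qp≡q′p) = cong G (ℤ.*-cancelʳ-≡ q′ q (+ p) (sym qp≡q′p))
  ... | no  p∤qp                = contradiction (divides q refl) p∤qp

  dilate-∤ : ∀ G {y} → ¬ (+ p ℤ.∣ y) → dilate p G y ≡ 0ℤ
  dilate-∤ G {y} p∤y with + p ∣? y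
  ... | yes p∣y = contradiction p∣y p∤y
  ... | no  _   = refl

sieve-∣ : ∀ {p y} → + p ℤ.∣ y → sieve p y ≡ + p
sieve-∣ {p} {y} p∣y with + p ∣? y
... | yes _   = refl
... | no  p∤y = contradiction p∣y p∤y

sieve-∤ : ∀ {p y} → ¬ (+ p ℤ.∣ y) → sieve p y ≡ 0ℤ
sieve-∤ {p} {y} p∤y with + p ∣? y
... | yes p∣y = contradiction p∣y p∤y
... | no  _   = refl

sieve-invariant : ∀ {p} y {z} → + p ℤ.∣ z → sieve p (y + z) ≡ sieve p y
sieve-invariant {p} y p∣z with + p ∣? y
... | yes p∣y = sieve-∣ (ℤ.∣m∣n⇒∣m+n p∣y p∣z)
... | no  p∤y = sieve-∤ (λ p∣y+z → p∤y (ℤ.∣m+n∣n⇒∣m p∣y+z p∣z))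

pos[p*N]≡N*p : ∀ p N → + (p ℕ.* N) ≡ + N * + p
pos[p*N]≡N*p p N = trans (ℤ.pos-* p N) (ℤ.*-comm (+ p) (+ N))

module _ {p N G} (p-prime : Prime p) (K : RamanujanKernel N G) where
  open RamanujanKernel K
  open KernelProperties K

  private instance
    p≢0 : NonZero p
    p≢0 = prime⇒nonZero p-prime

  N∣θ⇒pN∣θp : ∀ {θ} → + N ℤ.∣ θ → + (p ℕ.* N) ℤ.∣ θ * + p
  N∣θ⇒pN∣θp N∣θ = subst (ℤ._∣ _) (sym (pos[p*N]≡N*p p N)) (ℤ.*-monoˡ-∣ (+ p) N∣θ)

  p∣z[pN] : ∀ z → + p ℤ.∣ z * + (p ℕ.* N)
  p∣z[pN] z = ℤ.∣n⇒∣m*n z (subst (+ p ℤ.∣_) (sym (ℤ.pos-* p N)) (ℤ.∣m⇒∣m*n (+ N) ℤ.∣-refl))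

  dilate-periodic : ∀ y z → dilate p G (y + z * + (p ℕ.* N)) ≡ dilate p G y
  dilate-periodic y z with + p ∣? y
  ... | yes (divides q refl) = begin
    dilate p G (q * + p + z * + (p ℕ.* N)) ≡⟨ cong (λ u → dilate p G (q * + p + z * u)) (pos[p*N]≡N*p p N) ⟩
    dilate p G (q * + p + z * (+ N * + p)) ≡⟨ cong (dilate p G) (ring q z (+ N) (+ p)) ⟩
    dilate p G ((q + z * + N) * + p)       ≡⟨ dilate-* G (q + z * + N) ⟩
    G (q + z * + N)                        ≡⟨ periodic q z ⟩
    G q                                    ∎
    where
    open ≡-Reasoning
    ring : ∀ q z n p → q * p + z * (n * p) ≡ (q + z * n) * p
    ring = solve-∀
  ... | no p∤y = dilate-∤ G (λ p∣ → p∤y (ℤ.∣m+n∣n⇒∣m p∣ (p∣z[pN] z)))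

  dilate-∑-vanishes : p ℕ.∣ N → ∀ θ c → ¬ (+ (p ℕ.* N) ℤ.∣ θ) →
                      ∑[ x < p ℕ.* N ] dilate p G (+ x * θ + c) ≡ 0ℤ
  dilate-∑-vanishes p∣N θ c pN∤θ with + p ∣? θ | + p ∣? c
  ... | yes (divides θ′ refl) | yes (divides c′ refl) = begin
    ∑[ x < p ℕ.* N ] dilate p G (+ x * (θ′ * + p) + c′ * + p)
      ≡⟨ ∑-cong (p ℕ.* N) (λ x _ → trans (cong (dilate p G) (ring (+ x) θ′ c′ (+ p))) (dilate-* G _)) ⟩
    ∑[ x < p ℕ.* N ] G (+ x * θ′ + c′)
      ≡⟨ ∑-progression p θ′ c′ ⟩
    + p * ∑[ x < N ] G (+ x * θ′ + c′)
      ≡⟨ cong (+ p *_) (∑-vanishes θ′ c′ (pN∤θ ∘ N∣θ⇒pN∣θp)) ⟩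
    + p * 0ℤ
      ≡⟨ ℤ.*-zeroʳ (+ p) ⟩
    0ℤ ∎
    where
    open ≡-Reasoning
    ring : ∀ x θ c p → x * (θ * p) + c * p ≡ (x * θ + c) * p
    ring = solve-∀
  ... | yes p∣θ | no p∤c =
    ∑-zero (p ℕ.* N) λ x _ → dilate-∤ G λ p∣xθ+c →
      p∤c (ℤ.∣m+n∣m⇒∣n p∣xθ+c (ℤ.∣n⇒∣m*n (+ x) p∣θ))
  ... | no p∤θ | _ = sifted (∃-linear-root p-prime c p∤θ)
    where
    open ≡-Reasoning
    sifted : (∃ λ r → r < p × + p ℤ.∣ + r * θ + c) → ∑[ x < p ℕ.* N ] dilate p G (+ x * θ + c) ≡ 0ℤ
    sifted (r₀ , r₀<p , r₀-root@(divides c₀ r₀θ+c≡c₀p)) = begin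
      ∑[ x < p ℕ.* N ] dilate p G (+ x * θ + c)
        ≡⟨ ∑-sift p-prime N (dilate p G) p∤θ r₀<p r₀-root (λ _ → dilate-∤ G) ⟩
      ∑[ t < N ] dilate p G (+ t * (+ p * θ) + (+ r₀ * θ + c))
        ≡⟨ ∑-cong N (λ t _ → trans (cong (dilate p G) (rescale t)) (dilate-* G _)) ⟩
      ∑[ t < N ] G (+ t * θ + c₀)
        ≡⟨ ∑-vanishes θ c₀ (λ N∣θ → p∤θ (ℤ.∣-trans (ℤ.∣ᵤ⇒∣ p∣N) N∣θ)) ⟩
      0ℤ ∎
      where
      rescale : ∀ t → + t * (+ p * θ) + (+ r₀ * θ + c) ≡ (+ t * θ + c₀) * + p
      rescale t = trans (cong (λ u → + t * (+ p * θ) + u) r₀θ+c≡c₀p) (ring (+ t) (+ p) θ c₀)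
        where
        ring : ∀ t p θ c₀ → t * (p * θ) + c₀ * p ≡ (t * θ + c₀) * p
        ring = solve-∀

  dilate-kernel : p ℕ.∣ N → RamanujanKernel (p ℕ.* N) (dilate p G)
  dilate-kernel p∣N = record
    { periodic     = dilate-periodic
    ; nonzero-at-0 = nonzero-at-0 ∘ trans (sym (dilate-* G 0ℤ))
    ; ∑-vanishes   = dilate-∑-vanishes p∣N
    }

  twist-periodic : ∀ y z → twist p G (y + z * + (p ℕ.* N)) ≡ twist p G y
  twist-periodic y z = cong₂ (λ s g → s * g - g) (sieve-invariant y (p∣z[pN] z))
    (trans (cong (λ u → G (y + u)) (trans (cong (z *_) (pos[p*N]≡N*p p N)) (ring z (+ N) (+ p))))
           (periodic y (z * + p)))
    where
    ring : ∀ z n p → z * (n * p) ≡ z * p * n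
    ring = solve-∀

  twist-nonzero-at-0 : twist p G 0ℤ ≢ 0ℤ
  twist-nonzero-at-0 twist≡0 = ℕ.<-irrefl (sym p≡1) (ℕ.nonTrivial⇒n>1 p {{prime⇒nonTrivial p-prime}})
    where
    pG≡1G : + p * G 0ℤ ≡ 1ℤ * G 0ℤ
    pG≡1G = trans (ℤ.i-j≡0⇒i≡j _ _ (trans (cong (λ s → s * G 0ℤ - G 0ℤ) sieve[0]≡p) twist≡0))
                  (sym (ℤ.*-identityˡ (G 0ℤ)))
      where
      sieve[0]≡p : + p ≡ sieve p 0ℤ
      sieve[0]≡p = sym (sieve-∣ {p} {0ℤ} (divides 0ℤ refl))
    p≡1 : p ≡ 1
    p≡1 = ℤ.+-injective (ℤ.*-cancelʳ-≡ (+ p) 1ℤ (G 0ℤ) {{ℤ.≢-nonZero nonzero-at-0}} pG≡1G)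

  module _ (N⊥p : Coprime N p) where

    N∣pθ⇒N∣θ : ∀ {θ} → + N ℤ.∣ + p * θ → + N ℤ.∣ θ
    N∣pθ⇒N∣θ {θ} N∣pθ = ℤ.∣ᵤ⇒∣ (ℤ.coprime-divisor (+ N) (+ p) θ N⊥p (ℤ.∣⇒∣ᵤ N∣pθ))

    ∑-rescale : ∀ θ c r → ∑[ t < N ] G (+ t * (+ p * θ) + (+ r * θ + c)) ≡ ∑[ x < N ] G (+ x * θ + c)
    ∑-rescale θ c r with + N ∣? θ
    ... | yes N∣θ = begin
      ∑[ t < N ] G (+ t * (+ p * θ) + (+ r * θ + c)) ≡⟨ ∑-multiple N _ (ℤ.∣n⇒∣m*n (+ p) N∣θ) ⟩
      + N * G (+ r * θ + c)                          ≡⟨ cong (λ u → + N * G u) (ℤ.+-comm (+ r * θ) c) ⟩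
      + N * G (c + + r * θ)                          ≡⟨ cong (+ N *_) (∣⇒G-invariant c (ℤ.∣n⇒∣m*n (+ r) N∣θ)) ⟩
      + N * G c                                      ≡⟨ ∑-multiple N c N∣θ ⟨
      ∑[ x < N ] G (+ x * θ + c)                     ∎
      where open ≡-Reasoning
    ... | no  N∤θ = trans (∑-vanishes (+ p * θ) _ (N∤θ ∘ N∣pθ⇒N∣θ)) (sym (∑-vanishes θ c N∤θ))

    ∑-sieve* : ∀ θ c → ¬ (+ (p ℕ.* N) ℤ.∣ θ) →
               ∑[ x < p ℕ.* N ] (sieve p (+ x * θ + c) * G (+ x * θ + c)) ≡ + p * ∑[ x < N ] G (+ x * θ + c)
    ∑-sieve* θ c pN∤θ with + p ∣? θ
    ... | yes p∣θ@(divides θ′ refl) = begin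
      ∑[ x < p ℕ.* N ] (sieve p (+ x * θ + c) * G (+ x * θ + c))
        ≡⟨ ∑-cong (p ℕ.* N) (λ x _ → cong (_* G (+ x * θ + c))
              (trans (cong (sieve p) (ℤ.+-comm (+ x * θ) c)) (sieve-invariant c (ℤ.∣n⇒∣m*n (+ x) p∣θ)))) ⟩
      ∑[ x < p ℕ.* N ] (sieve p c * G (+ x * θ + c))
        ≡⟨ ∑-distribˡ-* (p ℕ.* N) (sieve p c) _ ⟩
      sieve p c * ∑[ x < p ℕ.* N ] G (+ x * θ + c)
        ≡⟨ cong (sieve p c *_) (∑-progression p θ c) ⟩
      sieve p c * (+ p * T)
        ≡⟨ cong (λ u → sieve p c * (+ p * u)) T≡0 ⟩
      sieve p c * (+ p * 0ℤ)
        ≡⟨ ring (sieve p c) (+ p) ⟩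
      + p * 0ℤ
        ≡⟨ cong (+ p *_) T≡0 ⟨
      + p * T ∎
      where
      open ≡-Reasoning
      T = ∑[ x < N ] G (+ x * θ + c)
      ring : ∀ s p → s * (p * 0ℤ) ≡ p * 0ℤ
      ring = solve-∀
      T≡0 : T ≡ 0ℤ
      T≡0 = ∑-vanishes θ c λ N∣θ′p →
        pN∤θ (N∣θ⇒pN∣θp (N∣pθ⇒N∣θ (subst (+ N ℤ.∣_) (ℤ.*-comm θ′ (+ p)) N∣θ′p)))
    ... | no p∤θ = sifted (∃-linear-root p-prime c p∤θ)
      where
      open ≡-Reasoning
      sifted : (∃ λ r → r < p × + p ℤ.∣ + r * θ + c) →
               ∑[ x < p ℕ.* N ] (sieve p (+ x * θ + c) * G (+ x * θ + c)) ≡ + p * ∑[ x < N ] G (+ x * θ + c)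
      sifted (r₀ , r₀<p , r₀-root) = begin
        ∑[ x < p ℕ.* N ] (sieve p (+ x * θ + c) * G (+ x * θ + c))
          ≡⟨ ∑-sift p-prime N (λ y → sieve p y * G y) p∤θ r₀<p r₀-root
                    (λ y p∤y → trans (cong (_* G y) (sieve-∤ p∤y)) (ℤ.*-zeroˡ (G y))) ⟩
        ∑[ t < N ] (sieve p (+ t * (+ p * θ) + c₁) * G (+ t * (+ p * θ) + c₁))
          ≡⟨ ∑-cong N (λ t _ → cong (_* G (+ t * (+ p * θ) + c₁)) (sieve-∣ (ℤ.∣m∣n⇒∣m+n (p∣t[pθ] t) r₀-root))) ⟩
        ∑[ t < N ] (+ p * G (+ t * (+ p * θ) + c₁))
          ≡⟨ ∑-distribˡ-* N (+ p) _ ⟩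
        + p * ∑[ t < N ] G (+ t * (+ p * θ) + c₁)
          ≡⟨ cong (+ p *_) (∑-rescale θ c r₀) ⟩
        + p * ∑[ x < N ] G (+ x * θ + c) ∎
        where
        c₁ = + r₀ * θ + c
        p∣t[pθ] : ∀ t → + p ℤ.∣ + t * (+ p * θ)
        p∣t[pθ] t = ℤ.∣n⇒∣m*n (+ t) (ℤ.∣m⇒∣m*n θ ℤ.∣-refl)

    twist-∑-vanishes : ∀ θ c → ¬ (+ (p ℕ.* N) ℤ.∣ θ) → ∑[ x < p ℕ.* N ] twist p G (+ x * θ + c) ≡ 0ℤ
    twist-∑-vanishes θ c pN∤θ = begin
      ∑[ x < p ℕ.* N ] twist p G (+ x * θ + c)
        ≡⟨ ∑-distrib-- (p ℕ.* N) (λ x → sieve p (+ x * θ + c) * G (+ x * θ + c)) (λ x → G (+ x * θ + c)) ⟩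
      ∑[ x < p ℕ.* N ] (sieve p (+ x * θ + c) * G (+ x * θ + c)) - ∑[ x < p ℕ.* N ] G (+ x * θ + c)
        ≡⟨ cong₂ _-_ (∑-sieve* θ c pN∤θ) (∑-progression p θ c) ⟩
      + p * ∑[ x < N ] G (+ x * θ + c) - + p * ∑[ x < N ] G (+ x * θ + c)
        ≡⟨ ℤ.+-inverseʳ (+ p * ∑[ x < N ] G (+ x * θ + c)) ⟩
      0ℤ ∎
      where open ≡-Reasoning

    twist-kernel : RamanujanKernel (p ℕ.* N) (twist p G)
    twist-kernel = record
      { periodic     = twist-periodic
      ; nonzero-at-0 = twist-nonzero-at-0
      ; ∑-vanishes   = twist-∑-vanishes
      }

∃-kernel : ∀ (ps : List ℕ) → All Prime ps → ∃ (RamanujanKernel (product ps))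
∃-kernel []       []                 = (λ _ → 1ℤ) , unit-kernel
∃-kernel (p ∷ ps) (p-prime ∷ ps-prime) with ∃-kernel ps ps-prime | p ℕ.∣? product ps
... | G , K | yes p∣N = dilate p G , dilate-kernel p-prime K p∣N
... | G , K | no  p∤N = twist p G , twist-kernel p-prime K (∤⇒coprime p-prime p∤N)

ramanujan-kernel : ∀ N .{{_ : NonZero N}} → ∃ (RamanujanKernel N)
ramanujan-kernel N = subst (∃ ∘ RamanujanKernel) (sym isFactorisation) (∃-kernel factors factorsPrime)
  where open PrimeFactorisation (factorise N)

private variable
  k : ℕ

_Δ_ : Subset k → Subset k → Subset k
_Δ_ = zipWith _xor_

∈Δ⁻ : ∀ (I J : Subset k) {x} → x ∈ I Δ J → x ∈ I ⊎ x ∈ J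
∈Δ⁻ (inside  ∷ I) (outside ∷ J) here       = inj₁ here
∈Δ⁻ (outside ∷ I) (inside  ∷ J) here       = inj₂ here
∈Δ⁻ (_       ∷ I) (_       ∷ J) (there x∈) with ∈Δ⁻ I J x∈
... | inj₁ x∈I = inj₁ (there x∈I)
... | inj₂ x∈J = inj₂ (there x∈J)

Δ-⊆ : ∀ {I J R : Subset k} → I ⊆ R → J ⊆ R → I Δ J ⊆ R
Δ-⊆ {I = I} {J} I⊆R J⊆R x∈IΔJ = [ I⊆R , J⊆R ]′ (∈Δ⁻ I J x∈IΔJ)

∈∧∈⇒∉Δ : ∀ {I J : Subset k} {s} → s ∈ I → s ∈ J → s ∉ I Δ J
∈∧∈⇒∉Δ here        here        ()
∈∧∈⇒∉Δ (there s∈I) (there s∈J) (there s∈IΔJ) = ∈∧∈⇒∉Δ s∈I s∈J s∈IΔJ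

∈∧∉⇒∈Δ : ∀ {I J : Subset k} {s} → s ∈ I → s ∉ J → s ∈ I Δ J
∈∧∉⇒∈Δ {J = inside  ∷ J} here        s∉J = contradiction here s∉J
∈∧∉⇒∈Δ {J = outside ∷ J} here        s∉J = here
∈∧∉⇒∈Δ {J = _       ∷ J} (there s∈I) s∉J = there (∈∧∉⇒∈Δ s∈I (s∉J ∘ there))

∉⇒[]≔outside-id : ∀ {I : Subset k} {s} → s ∉ I → I [ s ]≔ outside ≡ I
∉⇒[]≔outside-id {I = inside  ∷ I} {zero}  s∉I = contradiction here s∉I
∉⇒[]≔outside-id {I = outside ∷ I} {zero}  s∉I = refl
∉⇒[]≔outside-id {I = b       ∷ I} {suc s} s∉I = cong (b ∷_) (∉⇒[]≔outside-id (s∉I ∘ there))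

∈⇒[]≔inside-id : ∀ {I : Subset k} {s} → s ∈ I → I [ s ]≔ inside ≡ I
∈⇒[]≔inside-id {I = I} {s} s∈I = trans (cong (I [ s ]≔_) (sym (Vec.[]=⇒lookup s∈I))) (Vec.[]≔-lookup I s)

∉[]≔outside : ∀ (R : Subset k) s → s ∉ R [ s ]≔ outside
∉[]≔outside R s s∈ with () ← Vec.[]=-injective s∈ (Vec.[]≔-updates R s)

∉∧⊆⇒⊆[]≔outside : ∀ {I R : Subset k} {s} → s ∉ I → I ⊆ R → I ⊆ R [ s ]≔ outside
∉∧⊆⇒⊆[]≔outside {R = R} {s} s∉I I⊆R {x} x∈I = Vec.[]≔-minimal R x s (λ { refl → s∉I x∈I }) (I⊆R x∈I)

[]≔outside-mono : ∀ {I R : Subset k} s → I ⊆ R → I [ s ]≔ outside ⊆ R [ s ]≔ outside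
[]≔outside-mono {I = I} {R} s I⊆R {x} x∈I′ = Vec.[]≔-minimal R x s x≢s (I⊆R x∈I)
  where
  x≢s : x ≢ s
  x≢s refl with () ← Vec.[]=-injective x∈I′ (Vec.[]≔-updates I s)
  x∈I : x ∈ I
  x∈I = Vec.lookup⇒[]= x I (trans (sym (Vec.lookup∘update′ x≢s I outside)) (Vec.[]=⇒lookup x∈I′))

∣p∣≥1⇒Nonempty : ∀ (p : Subset k) → 1 ≤ ∣ p ∣ → Nonempty p
∣p∣≥1⇒Nonempty (inside  ∷ p) _ = zero , here
∣p∣≥1⇒Nonempty (outside ∷ p) 1≤∣p∣ with x , x∈p ← ∣p∣≥1⇒Nonempty p 1≤∣p∣ = suc x , there x∈p

∣p∩q∣≤1+∣p[x]≔outside∩q∣ : ∀ (p q : Subset k) x → ∣ p ∩ q ∣ ≤ suc ∣ (p [ x ]≔ outside) ∩ q ∣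
∣p∩q∣≤1+∣p[x]≔outside∩q∣ (b ∷ p) (c ∷ q) zero with b ∧ c
... | inside  = ℕ.≤-refl
... | outside = ℕ.n≤1+n _
∣p∩q∣≤1+∣p[x]≔outside∩q∣ (b ∷ p) (c ∷ q) (suc x) with b ∧ c
... | inside  = s≤s (∣p∩q∣≤1+∣p[x]≔outside∩q∣ p q x)
... | outside = ∣p∩q∣≤1+∣p[x]≔outside∩q∣ p q x

count⊆ : ∀ {P : Subset k → Set} → Subset k → Decidable P → ℕ
count⊆ []            P? = if does (P? []) then 1 else 0
count⊆ (outside ∷ R) P? = count⊆ R (P? ∘ (outside ∷_))
count⊆ (inside  ∷ R) P? = count⊆ R (P? ∘ (outside ∷_)) ℕ.+ count⊆ R (P? ∘ (inside ∷_))

count⊆-mono : ∀ {P Q : Subset k → Set} (R : Subset k) (P? : Decidable P) (Q? : Decidable Q) →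
              (∀ {I} → I ⊆ R → P I → Q I) → count⊆ R P? ≤ count⊆ R Q?
count⊆-mono []            P? Q? P⇒Q with P? [] | Q? []
... | no  _ | _     = z≤n
... | yes _ | yes _ = ℕ.≤-refl
... | yes p | no ¬q = contradiction (P⇒Q (λ x∈ → x∈) p) ¬q
count⊆-mono (outside ∷ R) P? Q? P⇒Q = count⊆-mono R _ _ (P⇒Q ∘ out⊆)
count⊆-mono (inside  ∷ R) P? Q? P⇒Q =
  ℕ.+-mono-≤ (count⊆-mono R _ _ (P⇒Q ∘ out⊆)) (count⊆-mono R _ _ (P⇒Q ∘ s⊆s))

count⊆-pos : ∀ {P : Subset k → Set} (R : Subset k) (P? : Decidable P) {I} → I ⊆ R → P I → 1 ≤ count⊆ R P?
count⊆-pos []            P? {[]}          _   p with P? []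
... | yes _ = ℕ.≤-refl
... | no ¬p = contradiction p ¬p
count⊆-pos (outside ∷ R) P? {outside ∷ I} I⊆R p = count⊆-pos R _ (drop-∷-⊆ I⊆R) p
count⊆-pos (outside ∷ R) P? {inside  ∷ I} I⊆R p with () ← I⊆R here
count⊆-pos (inside  ∷ R) P? {outside ∷ I} I⊆R p =
  ℕ.≤-trans (count⊆-pos R _ (drop-∷-⊆ I⊆R) p) (ℕ.m≤m+n _ _)
count⊆-pos (inside  ∷ R) P? {inside  ∷ I} I⊆R p =
  ℕ.≤-trans (count⊆-pos R _ (drop-∷-⊆ I⊆R) p) (ℕ.m≤n+m _ _)

count⊆-split : ∀ {P : Subset k → Set} (R : Subset k) (P? : Decidable P) {s} → s ∈ R →
               count⊆ R P? ≡ count⊆ (R [ s ]≔ outside) (P? ∘ (_[ s ]≔ outside))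
                             ℕ.+ count⊆ (R [ s ]≔ outside) (P? ∘ (_[ s ]≔ inside))
count⊆-split (inside  ∷ R) P? here        = refl
count⊆-split (outside ∷ R) P? (there s∈R) = count⊆-split R _ s∈R
count⊆-split {P = P} (inside ∷ R) P? {suc s} (there s∈R) =
  trans (cong₂ ℕ._+_ (count⊆-split R _ s∈R) (count⊆-split R _ s∈R))
        (interchange (half outside outside) (half outside inside) (half inside outside) (half inside inside))
  where
  half : Side → Side → ℕ
  half b c = count⊆ (R [ s ]≔ outside) (λ I → P? (b ∷ I [ s ]≔ c))

weight : (Fin k → ℤ) → Subset k → ℤ
weight C []      = 0ℤ
weight C (b ∷ I) = (if b then C zero else 0ℤ) + weight (C ∘ suc) I

weight-⊥ : ∀ (C : Fin k → ℤ) → weight C ⊥ ≡ 0ℤ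
weight-⊥ {zero}  C = refl
weight-⊥ {suc k} C = trans (ℤ.+-identityˡ _) (weight-⊥ (C ∘ suc))

weight-[]≔inside : ∀ C (I : Subset k) s → weight C (I [ s ]≔ inside) ≡ weight C (I [ s ]≔ outside) + C s
weight-[]≔inside C (b ∷ I) zero    = ring (C zero) (weight (C ∘ suc) I)
  where
  ring : ∀ c w → c + w ≡ (0ℤ + w) + c
  ring = solve-∀
weight-[]≔inside C (b ∷ I) (suc s) =
  trans (cong (λ u → h + u) (weight-[]≔inside (C ∘ suc) I s)) (sym (ℤ.+-assoc h _ (C (suc s))))
  where h = if b then C zero else 0ℤ

negateOn : Subset k → (Fin k → ℤ) → Fin k → ℤ
negateOn J C s = if lookup J s then - C s else C s

weight-Δ : ∀ C (I J : Subset k) → weight C (I Δ J) ≡ weight (negateOn J C) I + weight C J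
weight-Δ C []      []      = refl
weight-Δ C (i ∷ I) (j ∷ J) = begin
  (if i xor j then c else 0ℤ) + weight (C ∘ suc) (I Δ J)
    ≡⟨ cong₂ _+_ (head i j) (weight-Δ (C ∘ suc) I J) ⟩
  ((if i then (if j then - c else c) else 0ℤ) + (if j then c else 0ℤ))
    + (weight (negateOn J (C ∘ suc)) I + weight (C ∘ suc) J)
    ≡⟨ interchangeℤ (if i then (if j then - c else c) else 0ℤ) (if j then c else 0ℤ)
                    (weight (negateOn J (C ∘ suc)) I) (weight (C ∘ suc) J) ⟩
  ((if i then (if j then - c else c) else 0ℤ) + weight (negateOn J (C ∘ suc)) I)
    + ((if j then c else 0ℤ) + weight (C ∘ suc) J) ∎
  where
  open ≡-Reasoning
  c = C zero
  head : ∀ i j → (if i xor j then c else 0ℤ) ≡ (if i then (if j then - c else c) else 0ℤ) + (if j then c else 0ℤ)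
  head inside  inside  = sym (ℤ.+-inverseˡ c)
  head inside  outside = sym (ℤ.+-identityʳ c)
  head outside inside  = sym (ℤ.+-identityˡ c)
  head outside outside = refl
  interchangeℤ : ∀ a b x y → (a + b) + (x + y) ≡ (a + x) + (b + y)
  interchangeℤ = solve-∀

altSum : Subset k → (Subset k → ℤ) → ℤ
altSum []            f = f []
altSum (outside ∷ R) f = altSum R (f ∘ (outside ∷_))
altSum (inside  ∷ R) f = altSum R (f ∘ (outside ∷_)) - altSum R (f ∘ (inside ∷_))

altSum-cong : ∀ (R : Subset k) {f g : Subset k → ℤ} → (∀ I → f I ≡ g I) → altSum R f ≡ altSum R g
altSum-cong []            f≗g = f≗g []
altSum-cong (outside ∷ R) f≗g = altSum-cong R (f≗g ∘ (outside ∷_))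
altSum-cong (inside  ∷ R) f≗g = cong₂ _-_ (altSum-cong R (f≗g ∘ (outside ∷_))) (altSum-cong R (f≗g ∘ (inside ∷_)))

altSum-toggle : ∀ (R : Subset k) {s} (f : Subset k → ℤ) → s ∈ R →
                (∀ I → f (I [ s ]≔ inside) ≡ f (I [ s ]≔ outside)) → altSum R f ≡ 0ℤ
altSum-toggle (inside ∷ R) f here f-toggle =
  trans (cong (λ u → altSum R (f ∘ (outside ∷_)) - u) (altSum-cong R (f-toggle ∘ (outside ∷_))))
        (ℤ.+-inverseʳ (altSum R (f ∘ (outside ∷_))))
altSum-toggle (outside ∷ R) f (there s∈R) f-toggle = altSum-toggle R _ s∈R (f-toggle ∘ (outside ∷_))
altSum-toggle (inside  ∷ R) f (there s∈R) f-toggle =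
  cong₂ _-_ (altSum-toggle R _ s∈R (f-toggle ∘ (outside ∷_))) (altSum-toggle R _ s∈R (f-toggle ∘ (inside ∷_)))

altSum-∑ : ∀ (R : Subset k) M (h : ℕ → Subset k → ℤ) →
           altSum R (λ I → ∑[ x < M ] h x I) ≡ ∑[ x < M ] altSum R (h x)
altSum-∑ []            M h = refl
altSum-∑ (outside ∷ R) M h = altSum-∑ R M (λ x → h x ∘ (outside ∷_))
altSum-∑ (inside  ∷ R) M h =
  trans (cong₂ _-_ (altSum-∑ R M (λ x → h x ∘ (outside ∷_))) (altSum-∑ R M (λ x → h x ∘ (inside ∷_))))
        (sym (∑-distrib-- M (λ x → altSum R (h x ∘ (outside ∷_))) (λ x → altSum R (h x ∘ (inside ∷_)))))

altSum≢0⇒witness : ∀ (R : Subset k) g → altSum R g ≢ 0ℤ → ∃ λ I → I ⊆ R × g I ≢ 0ℤ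
altSum≢0⇒witness []            g g≢0 = [] , (λ x∈ → x∈) , g≢0
altSum≢0⇒witness (outside ∷ R) g Σ≢0 with I , I⊆R , gI≢0 ← altSum≢0⇒witness R _ Σ≢0 =
  outside ∷ I , out⊆ I⊆R , gI≢0
altSum≢0⇒witness (inside ∷ R) g Σ≢0 with altSum R (g ∘ (outside ∷_)) ℤ.≟ 0ℤ
... | no Σ₀≢0 with I , I⊆R , gI≢0 ← altSum≢0⇒witness R _ Σ₀≢0 = outside ∷ I , out⊆ I⊆R , gI≢0
... | yes Σ₀≡0 with I , I⊆R , gI≢0 ← altSum≢0⇒witness R _ (Σ≢0 ∘ cong₂ _-_ Σ₀≡0) =
  inside ∷ I , s⊆s I⊆R , gI≢0

private
  i≡j∧k≡0⇒i-k≡j : ∀ {i j k} → i ≡ j → k ≡ 0ℤ → i - k ≡ j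
  i≡j∧k≡0⇒i-k≡j {j = j} refl refl = ℤ.+-identityʳ j

altSum≢⊥⇒witness : ∀ (R : Subset k) g → altSum R g ≢ g ⊥ → ∃ λ I → I ⊆ R × Nonempty I × g I ≢ 0ℤ
altSum≢⊥⇒witness []            g Σ≢g⊥ = contradiction refl Σ≢g⊥
altSum≢⊥⇒witness (outside ∷ R) g Σ≢g⊥ with I , I⊆R , (x , x∈I) , gI≢0 ← altSum≢⊥⇒witness R _ Σ≢g⊥ =
  outside ∷ I , out⊆ I⊆R , (suc x , there x∈I) , gI≢0
altSum≢⊥⇒witness (inside ∷ R) g Σ≢g⊥ with altSum R (g ∘ (outside ∷_)) ℤ.≟ g ⊥
... | no Σ₀≢g⊥ with I , I⊆R , (x , x∈I) , gI≢0 ← altSum≢⊥⇒witness R _ Σ₀≢g⊥ =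
  outside ∷ I , out⊆ I⊆R , (suc x , there x∈I) , gI≢0
... | yes Σ₀≡g⊥ with I , I⊆R , gI≢0 ← altSum≢0⇒witness R _ (Σ≢g⊥ ∘ i≡j∧k≡0⇒i-k≡j Σ₀≡g⊥) =
  inside ∷ I , s⊆s I⊆R , (zero , here) , gI≢0

length-filter-map : ∀ {A B : Set} {P : B → Set} (P? : Decidable P) (f : A → B) xs →
                    length (filter P? (map f xs)) ≡ length (filter (P? ∘ f) xs)
length-filter-map P? f []       = refl
length-filter-map P? f (x ∷ xs) with does (P? (f x))
... | true  = cong suc (length-filter-map P? f xs)
... | false = length-filter-map P? f xs

length-filter-++ : ∀ {A : Set} {P : A → Set} (P? : Decidable P) xs ys →
                   length (filter P? (xs ++ ys)) ≡ length (filter P? xs) ℕ.+ length (filter P? ys)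
length-filter-++ P? xs ys = trans (cong length (List.filter-++ P? xs ys)) (List.length-++ (filter P? xs))

length-filter+length-filter-¬ : ∀ {A : Set} {P : A → Set} (P? : Decidable P) xs →
                                length (filter P? xs) ℕ.+ length (filter (¬? ∘ P?) xs) ≡ length xs
length-filter+length-filter-¬ P? []       = refl
length-filter+length-filter-¬ P? (x ∷ xs) with does (P? x)
... | true  = cong suc (length-filter+length-filter-¬ P? xs)
... | false = trans (ℕ.+-suc _ _) (cong suc (length-filter+length-filter-¬ P? xs))

filter-filter-length : ∀ {A : Set} {P Q : A → Set} (P? : Decidable P) (Q? : Decidable Q) xs →
                       (∀ {x} → P x → Q x) → length (filter P? (filter Q? xs)) ≡ length (filter P? xs)
filter-filter-length P? Q? []       P⇒Q = refl
filter-filter-length P? Q? (x ∷ xs) P⇒Q with Q? x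
... | yes _ with P? x
...   | yes _ = cong suc (filter-filter-length P? Q? xs P⇒Q)
...   | no  _ = filter-filter-length P? Q? xs P⇒Q
filter-filter-length P? Q? (x ∷ xs) P⇒Q | no ¬q with P? x
...   | yes p = contradiction (P⇒Q p) ¬q
...   | no  _ = filter-filter-length P? Q? xs P⇒Q

unique-fibres⇒length*≤ : ∀ {A B : Set} (f : A → B) (_≟_ : DecidableEquality B) b xs {ys} → Unique ys →
                          (∀ {y} → y List.∈ ys → b ≤ length (filter (λ x → f x ≟ y) xs)) →
                          length ys ℕ.* b ≤ length xs
unique-fibres⇒length*≤ f _≟_ b xs {[]}     []           large = z≤n
unique-fibres⇒length*≤ f _≟_ b xs {y ∷ ys} (y∉ys ∷ !ys) large = begin
  b ℕ.+ length ys ℕ.* b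
    ≤⟨ ℕ.+-mono-≤ (large (Any.here refl)) (unique-fibres⇒length*≤ f _≟_ b others !ys large-others) ⟩
  length (filter (λ x → f x ≟ y) xs) ℕ.+ length others
    ≡⟨ length-filter+length-filter-¬ (λ x → f x ≟ y) xs ⟩
  length xs ∎
  where
  open ℕ.≤-Reasoning
  others = filter (λ x → ¬? (f x ≟ y)) xs
  large-others : ∀ {y′} → y′ List.∈ ys → b ≤ length (filter (λ x → f x ≟ y′) others)
  large-others {y′} y′∈ys = ℕ.≤-trans (large (Any.there y′∈ys)) (ℕ.≤-reflexive (sym
    (filter-filter-length (λ x → f x ≟ y′) _ xs (λ { refl refl → All.lookup y∉ys y′∈ys refl }))))

length-allSubsets : ∀ k → length (allSubsets k) ≡ 2 ^ k
length-allSubsets zero    = refl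
length-allSubsets (suc k) = begin
  length (map (inside ∷_) (allSubsets k) ++ map (outside ∷_) (allSubsets k))
    ≡⟨ List.length-++ (map (inside ∷_) (allSubsets k)) ⟩
  length (map (inside ∷_) (allSubsets k)) ℕ.+ length (map (outside ∷_) (allSubsets k))
    ≡⟨ cong₂ ℕ._+_ (List.length-map _ (allSubsets k)) (List.length-map _ (allSubsets k)) ⟩
  length (allSubsets k) ℕ.+ length (allSubsets k)
    ≡⟨ cong₂ ℕ._+_ (length-allSubsets k) (trans (length-allSubsets k) (sym (ℕ.+-identityʳ (2 ^ k)))) ⟩
  2 ^ suc k ∎
  where open ≡-Reasoning

count⊆⊤≡length-filter : ∀ k {P : Subset k → Set} (P? : Decidable P) →
                        count⊆ ⊤ P? ≡ length (filter P? (allSubsets k))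
count⊆⊤≡length-filter zero    P? with does (P? [])
... | true  = refl
... | false = refl
count⊆⊤≡length-filter (suc k) P? = begin
  count⊆ ⊤ (P? ∘ (outside ∷_)) ℕ.+ count⊆ ⊤ (P? ∘ (inside ∷_))
    ≡⟨ ℕ.+-comm (count⊆ ⊤ (P? ∘ (outside ∷_))) (count⊆ ⊤ (P? ∘ (inside ∷_))) ⟩
  count⊆ ⊤ (P? ∘ (inside ∷_)) ℕ.+ count⊆ ⊤ (P? ∘ (outside ∷_))
    ≡⟨ cong₂ ℕ._+_ (count⊆⊤≡length-filter k _) (count⊆⊤≡length-filter k _) ⟩
  length (filter (P? ∘ (inside ∷_)) (allSubsets k)) ℕ.+ length (filter (P? ∘ (outside ∷_)) (allSubsets k))
    ≡⟨ cong₂ ℕ._+_ (length-filter-map P? _ (allSubsets k)) (length-filter-map P? _ (allSubsets k)) ⟨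
  length (filter P? (map (inside ∷_) (allSubsets k))) ℕ.+ length (filter P? (map (outside ∷_) (allSubsets k)))
    ≡⟨ length-filter-++ P? (map (inside ∷_) (allSubsets k)) _ ⟨
  length (filter P? (allSubsets (suc k))) ∎
  where open ≡-Reasoning

∈-tabulate-does : ∀ {k} {P : Fin k → Set} (P? : Decidable P) {x} → x ∈ tabulate (does ∘ P?) → P x
∈-tabulate-does P? {x} x∈ with P? x | trans (sym (Vec.lookup∘tabulate (does ∘ P?) x)) (Vec.[]=⇒lookup x∈)
... | yes Px | _ = Px

∣tabulate-does∣ : ∀ {k} {A : Set} (g : Fin k → A) {P : A → Set} (P? : Decidable P) →
                  ∣ tabulate (does ∘ P? ∘ g) ∣ ≡ length (filter P? (List.tabulate g))
∣tabulate-does∣ {zero}  g P? = refl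
∣tabulate-does∣ {suc k} g P? with does (P? (g zero))
... | true  = cong suc (∣tabulate-does∣ (g ∘ suc) P?)
... | false = ∣tabulate-does∣ (g ∘ suc) P?

module Covering {k} (a : Fin k → ℤ) (n : Fin k → ℕ) where

  covering : ℤ → Subset k
  covering x = tabulate (λ s → does (+ n s ∣? x - a s))

  IsCoverOn : ℕ → Subset k → Set
  IsCoverOn m R = ∀ x → m ≤ ∣ R ∩ covering x ∣

  IsMCover⇒IsCoverOn⊤ : ∀ {m} → IsMCover m k a n → IsCoverOn m ⊤
  IsMCover⇒IsCoverOn⊤ cover x =
    subst (_ ≤_) (sym (trans (cong ∣_∣ (∩-identityˡ (covering x)))
                             (∣tabulate-does∣ {k} (λ s → s) (λ s → + n s ∣? x - a s))))
                 (cover x)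

  IsCoverOn-remove : ∀ {m R} s → IsCoverOn (suc m) R → IsCoverOn m (R [ s ]≔ outside)
  IsCoverOn-remove {R = R} s R-cover x =
    ℕ.≤-pred (ℕ.≤-trans (R-cover x) (∣p∩q∣≤1+∣p[x]≔outside∩q∣ R (covering x) s))

  covered-by : ∀ {R} → IsCoverOn 1 R → ∀ x → ∃ λ s → s ∈ R × + n s ℤ.∣ x - a s
  covered-by {R} R-cover x with s , s∈R∩ ← ∣p∣≥1⇒Nonempty (R ∩ covering x) (R-cover x) =
    s , proj₁ (x∈p∩q⁻ R _ s∈R∩) , ∈-tabulate-does (λ s → + n s ∣? x - a s) (proj₂ (x∈p∩q⁻ R _ s∈R∩))

  module _ (N : ℕ) .{{_ : NonZero N}} where

    module _ {G} (K : RamanujanKernel N G) (C : Fin k → ℤ) (N∣Cn : ∀ s → + N ℤ.∣ C s * + n s) where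
      open RamanujanKernel K
      open KernelProperties K

      private
        Ca : Fin k → ℤ
        Ca s = C s * a s

      -- the analogue of ∏_{s ∈ I} e(Cₛ(x - aₛ)/N)
      phase : ℕ → Subset k → ℤ
      phase x I = G (+ x * weight C I - weight Ca I)

      phase-toggle : ∀ x {s} → + n s ℤ.∣ + x - a s → ∀ I → phase x (I [ s ]≔ inside) ≡ phase x (I [ s ]≔ outside)
      phase-toggle x {s} (divides q x-aₛ≡qnₛ) I = begin
        G (+ x * weight C (I [ s ]≔ inside) - weight Ca (I [ s ]≔ inside))
          ≡⟨ cong₂ (λ u v → G (+ x * u - v)) (weight-[]≔inside C I s) (weight-[]≔inside Ca I s) ⟩
        G (+ x * (w + C s) - (wa + C s * a s))
          ≡⟨ cong G (ring (+ x) w wa (C s) (a s)) ⟩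
        G (+ x * w - wa + C s * (+ x - a s))
          ≡⟨ ∣⇒G-invariant _ N∣Cₛ[x-aₛ] ⟩
        G (+ x * w - wa) ∎
        where
        open ≡-Reasoning
        w  = weight C  (I [ s ]≔ outside)
        wa = weight Ca (I [ s ]≔ outside)
        ring : ∀ x w wa c α → x * (w + c) - (wa + c * α) ≡ x * w - wa + c * (x - α)
        ring = solve-∀
        N∣Cₛ[x-aₛ] : + N ℤ.∣ C s * (+ x - a s)
        N∣Cₛ[x-aₛ] = subst (+ N ℤ.∣_) (trans (swap q (C s) (+ n s)) (cong (C s *_) (sym x-aₛ≡qnₛ)))
                           (ℤ.∣n⇒∣m*n q (N∣Cn s))
          where
          swap : ∀ q c n → q * (c * n) ≡ c * (q * n)
          swap = solve-∀

      ∑-phase-⊥ : ∑[ x < N ] phase x ⊥ ≡ + N * G 0ℤ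
      ∑-phase-⊥ = trans (∑-cong N λ x _ → cong₂ (λ u v → G (+ x * u - v)) (weight-⊥ C) (weight-⊥ Ca))
                        (trans (∑-cong N λ x _ → cong G (ring (+ x))) (∑-const N (G 0ℤ)))
        where
        ring : ∀ x → x * 0ℤ - 0ℤ ≡ 0ℤ
        ring = solve-∀

      zero-sum-subset-via : ∀ {R} → IsCoverOn 1 R → ∃ λ I → I ⊆ R × Nonempty I × + N ℤ.∣ weight C I
      zero-sum-subset-via {R} R-cover =
        let I , I⊆R , I≢∅ , ∑phase≢0 = altSum≢⊥⇒witness R (λ I → ∑[ x < N ] phase x I) altSum≢∑phase⊥
        in  I , I⊆R , I≢∅ , decidable-stable (+ N ∣? weight C I) (∑phase≢0 ∘ ∑-vanishes _ _)
        where
        altSum≡0 : altSum R (λ I → ∑[ x < N ] phase x I) ≡ 0ℤ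
        altSum≡0 = trans (altSum-∑ R N phase) (∑-zero N λ x _ →
          let s , s∈R , x∈aₛ = covered-by R-cover (+ x) in altSum-toggle R (phase x) s∈R (phase-toggle x x∈aₛ))

        altSum≢∑phase⊥ : altSum R (λ I → ∑[ x < N ] phase x I) ≢ ∑[ x < N ] phase x ⊥
        altSum≢∑phase⊥ altSum≡∑phase⊥ = nonzero-at-0 (ℤ.*-cancelˡ-≡ (+ N) (G 0ℤ) 0ℤ
          (trans (sym ∑-phase-⊥) (trans (sym altSum≡∑phase⊥) (trans altSum≡0 (sym (ℤ.*-zeroʳ (+ N)))))))

    zero-sum-subset : ∀ C → (∀ s → + N ℤ.∣ C s * + n s) → ∀ {R} → IsCoverOn 1 R →
                      ∃ λ I → I ⊆ R × Nonempty I × + N ℤ.∣ weight C I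
    zero-sum-subset C N∣Cn = zero-sum-subset-via (proj₂ (ramanujan-kernel N)) C N∣Cn

    module _ (C : Fin k → ℤ) where

      Hits : ℤ → Subset k → Set
      Hits t I = + N ℤ.∣ weight C I - t

      hits? : ∀ t → Decidable (Hits t)
      hits? t I = + N ∣? weight C I - t

      private
        shift : ∀ {t c} K K′ → weight C K ≡ weight C K′ + c → weight C K′ - (t - c) ≡ weight C K - t
        shift {t} {c} K K′ wK≡wK′+c = trans (ring (weight C K′) t c) (cong (_- t) (sym wK≡wK′+c))
          where
          ring : ∀ w t c → w - (t - c) ≡ w + c - t
          ring = solve-∀

      Hits-[]≔outside : ∀ {t K s} → s ∉ K → Hits t K → Hits t (K [ s ]≔ outside)
      Hits-[]≔outside {t} s∉K = subst (Hits t) (sym (∉⇒[]≔outside-id s∉K))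

      Hits-[]≔inside : ∀ {t K s} → s ∉ K → Hits (t - C s) K → Hits t (K [ s ]≔ inside)
      Hits-[]≔inside {K = K} {s} s∉K = subst (+ N ℤ.∣_) (shift (K [ s ]≔ inside) K
        (trans (weight-[]≔inside C K s) (cong (λ K′ → weight C K′ + C s) (∉⇒[]≔outside-id s∉K))))

      Hits-remove : ∀ {t L s} → s ∈ L → Hits t L → Hits (t - C s) (L [ s ]≔ outside)
      Hits-remove {L = L} {s} s∈L = subst (+ N ℤ.∣_) (sym (shift L (L [ s ]≔ outside)
        (trans (cong (weight C) (sym (∈⇒[]≔inside-id s∈L))) (weight-[]≔inside C L s))))

      Hits-Δ : ∀ {t} I J → + N ℤ.∣ weight (negateOn J C) I → Hits t J → Hits t (I Δ J)
      Hits-Δ {t} I J N∣w′ J-hits = subst (+ N ℤ.∣_)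
        (sym (trans (cong (_- t) (weight-Δ C I J)) (ℤ.+-assoc (weight (negateOn J C) I) (weight C J) (- t))))
        (ℤ.∣m∣n⇒∣m+n N∣w′ J-hits)

      module _ (N∣Cn : ∀ s → + N ℤ.∣ C s * + n s) where

        negateOn-preserves : ∀ J s → + N ℤ.∣ negateOn J C s * + n s
        negateOn-preserves J s with lookup J s
        ... | inside  = subst (+ N ℤ.∣_) (ℤ.neg-distribˡ-* (C s) (+ n s)) (ℤ.∣m⇒∣-m (N∣Cn s))
        ... | outside = N∣Cn s

        lower-bound : ∀ m {R} → IsCoverOn m R → ∀ {t J} → J ⊆ R → Hits t J → 2 ^ m ≤ count⊆ R (hits? t)
        lower-bound zero    {R} _       J⊆R J-hits = count⊆-pos R (hits? _) J⊆R J-hits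
        lower-bound (suc m) {R} R-cover {t} {J} J⊆R J-hits =
          split-at-difference (zero-sum-subset (negateOn J C) (negateOn-preserves J) (ℕ.≤-trans (s≤s z≤n) ∘ R-cover))
          where
          doubling : ∀ {s L₀ L₁} → s ∈ R → L₀ ⊆ R → s ∉ L₀ → Hits t L₀ →
                     L₁ ⊆ R → s ∈ L₁ → Hits t L₁ → 2 ^ suc m ≤ count⊆ R (hits? t)
          doubling {s} s∈R L₀⊆R s∉L₀ L₀-hits L₁⊆R s∈L₁ L₁-hits = begin
            2 ^ suc m
              ≡⟨ cong (2 ^ m ℕ.+_) (ℕ.+-identityʳ (2 ^ m)) ⟩
            2 ^ m ℕ.+ 2 ^ m
              ≤⟨ ℕ.+-mono-≤ (lower-bound m R′-cover (∉∧⊆⇒⊆[]≔outside s∉L₀ L₀⊆R) L₀-hits)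
                            (lower-bound m R′-cover ([]≔outside-mono s L₁⊆R) (Hits-remove s∈L₁ L₁-hits)) ⟩
            count⊆ R′ (hits? t) ℕ.+ count⊆ R′ (hits? (t - C s))
              ≤⟨ ℕ.+-mono-≤ (count⊆-mono R′ _ _ (Hits-[]≔outside ∘ s∉⊆R′))
                            (count⊆-mono R′ _ _ (Hits-[]≔inside ∘ s∉⊆R′)) ⟩
            count⊆ R′ (hits? t ∘ (_[ s ]≔ outside)) ℕ.+ count⊆ R′ (hits? t ∘ (_[ s ]≔ inside))
              ≡⟨ count⊆-split R (hits? t) s∈R ⟨
            count⊆ R (hits? t) ∎
            where
            open ℕ.≤-Reasoning
            R′ = R [ s ]≔ outside
            R′-cover = IsCoverOn-remove {R = R} s R-cover
            s∉⊆R′ : ∀ {K} → K ⊆ R′ → s ∉ K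
            s∉⊆R′ K⊆R′ = ∉[]≔outside R s ∘ K⊆R′

          split-at-difference : (∃ λ I′ → I′ ⊆ R × Nonempty I′ × + N ℤ.∣ weight (negateOn J C) I′) →
                                2 ^ suc m ≤ count⊆ R (hits? t)
          split-at-difference (I′ , I′⊆R , (s , s∈I′) , N∣w′) with s ∈? J
          ... | yes s∈J = doubling (I′⊆R s∈I′)
                                   (Δ-⊆ I′⊆R J⊆R) (∈∧∈⇒∉Δ s∈I′ s∈J) (Hits-Δ I′ J N∣w′ J-hits)
                                   J⊆R s∈J J-hits
          ... | no  s∉J = doubling (I′⊆R s∈I′) J⊆R s∉J J-hits
                                   (Δ-⊆ I′⊆R J⊆R) (∈∧∉⇒∈Δ s∈I′ s∉J) (Hits-Δ I′ J N∣w′ J-hits)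

sumℚ-suc : ∀ k (f : Fin (suc k) → ℚ) → sumℚ (suc k) f ≡ f zero ℚ.+ sumℚ k (f ∘ suc)
sumℚ-suc k f = cong (λ xs → f zero ℚ.+ List.foldr ℚ._+_ 0ℚ xs)
  (trans (List.map-tabulate suc f) (sym (List.map-tabulate (λ s → s) (f ∘ suc))))

subsetSum≡weight/ : ∀ {k} (n : Fin k → ℕ) (pos : ∀ s → NonZero (n s)) (ms : Fin k → ℤ) {N} .{{_ : NonZero N}}
                    (q : Fin k → ℕ) →
                    (∀ s → N ≡ q s ℕ.* n s) → ∀ I → subsetSum k n pos ms I ≡ weight (λ s → ms s * + q s) I / N
subsetSum≡weight/ {zero}  n pos ms {N} q N≡qn []      = sym (ℚ.0/n≡0 N)
subsetSum≡weight/ {suc k} n pos ms {N} q N≡qn (b ∷ I) = begin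
  sumℚ (suc k) term
    ≡⟨ sumℚ-suc k term ⟩
  term zero ℚ.+ subsetSum k (n ∘ suc) (pos ∘ suc) (ms ∘ suc) I
    ≡⟨ cong₂ ℚ._+_ (head b) (subsetSum≡weight/ (n ∘ suc) (pos ∘ suc) (ms ∘ suc) (q ∘ suc) (N≡qn ∘ suc) I) ⟩
  (if b then C zero else 0ℤ) / N ℚ.+ weight (C ∘ suc) I / N
    ≡⟨ /-+-/ (if b then C zero else 0ℤ) (weight (C ∘ suc) I) N ⟩
  weight C (b ∷ I) / N ∎
  where
  open ≡-Reasoning
  C : Fin (suc k) → ℤ
  C s = ms s * + q s
  term : Fin (suc k) → ℚ
  term s = if lookup (b ∷ I) s then (ms s / n s) {{pos s}} else 0ℚ
  head : ∀ b → (if b then (ms zero / n zero) {{pos zero}} else 0ℚ) ≡ (if b then C zero else 0ℤ) / N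
  head inside  = /-cong-* (ms zero) (q zero) {{pos zero}} (N≡qn zero)
  head outside = sym (ℚ.0/n≡0 N)

module _ {k} (a : Fin k → ℤ) (n : Fin k → ℕ) (pos : ∀ s → NonZero (n s)) (ms : Fin k → ℤ) where
  open Covering a n

  private
    N : ℕ
    N = product (List.tabulate n)

    instance
      N≢0 : NonZero N
      N≢0 = product≢0 (tabulate⁺ pos)

    q : Fin k → ℕ
    q s = (N ℕ./ n s) {{pos s}}

    N≡qn : ∀ s → N ≡ q s ℕ.* n s
    N≡qn s = sym (ℕ.m/n*n≡m {{pos s}} (∈⇒∣product (∈-tabulate⁺ s)))

    C : Fin k → ℤ
    C s = ms s * + q s

    N∣Cn : ∀ s → + N ℤ.∣ C s * + n s
    N∣Cn s = divides (ms s) (trans (ℤ.*-assoc (ms s) (+ q s) (+ n s))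
                                   (cong (ms s *_) (trans (sym (ℤ.pos-* (q s) (n s))) (cong +_ (sym (N≡qn s))))))

  fracSum : Subset k → ℚ
  fracSum I = frac (subsetSum k n pos ms I)

  fibre-bound : ∀ {m} → IsMCover m k a n → ∀ J →
                2 ^ m ≤ length (List.filter (λ I → fracSum I ℚ.≟ fracSum J) (allSubsets k))
  fibre-bound {m} cover J = begin
    2 ^ m
      ≤⟨ lower-bound N C N∣Cn m (IsMCover⇒IsCoverOn⊤ cover) {J = J} ⊆⊤ J-hits ⟩
    count⊆ ⊤ (hits? N C (weight C J))
      ≤⟨ count⊆-mono ⊤ (hits? N C (weight C J)) (λ I → fracSum I ℚ.≟ fracSum J) (λ {I} _ → same-frac {I}) ⟩
    count⊆ ⊤ (λ I → fracSum I ℚ.≟ fracSum J)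
      ≡⟨ count⊆⊤≡length-filter k _ ⟩
    length (List.filter (λ I → fracSum I ℚ.≟ fracSum J) (allSubsets k)) ∎
    where
    open ℕ.≤-Reasoning
    J-hits : Hits N C (weight C J) J
    J-hits = divides 0ℤ (trans (ℤ.+-inverseʳ (weight C J)) (sym (ℤ.*-zeroˡ (+ N))))
    fracSum≡ : ∀ I → fracSum I ≡ frac (weight C I / N)
    fracSum≡ I = cong frac (subsetSum≡weight/ n pos ms q N≡qn I)
    same-frac : ∀ {I} → Hits N C (weight C J) I → fracSum I ≡ fracSum J
    same-frac {I} N∣wI-wJ = trans (fracSum≡ I) (trans (frac-/-cong {weight C I} {weight C J} N N∣wI-wJ) (sym (fracSum≡ J)))

corollary1p1 : (m k : ℕ) → NonZero m →
    (a : Fin k → ℤ) (n : Fin k → ℕ) (pos : ∀ s → NonZero (n s)) →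
    IsMCover m k a n →
    (ms : Fin k → ℤ) →
    length (SA k n pos ms) ≤ 2 ^ (k ∸ m)
corollary1p1 m k _ a n pos cover ms = ℕ.*-cancelʳ-≤ _ _ (2 ^ m) {{ℕ.m^n≢0 2 m}} (begin
  length (SA k n pos ms) ℕ.* 2 ^ m
    ≤⟨ unique-fibres⇒length*≤ (fracSum a n pos ms) ℚ._≟_ (2 ^ m) (allSubsets k) (deduplicate-! _) large-fibres ⟩
  length (allSubsets k)        ≡⟨ length-allSubsets k ⟩
  2 ^ k                        ≡⟨ cong (2 ^_) (ℕ.m∸n+n≡m m≤k) ⟨
  2 ^ (k ∸ m ℕ.+ m)            ≡⟨ ℕ.^-distribˡ-+-* 2 (k ∸ m) m ⟩
  2 ^ (k ∸ m) ℕ.* 2 ^ m        ∎)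
  where
  open ℕ.≤-Reasoning
  large-fibres : ∀ {v} → v List.∈ SA k n pos ms →
                 2 ^ m ≤ length (List.filter (λ I → fracSum a n pos ms I ℚ.≟ v) (allSubsets k))
  large-fibres v∈SA with J , _ , refl ← ∈-map⁻ (fracSum a n pos ms) (∈-deduplicate⁻ ℚ._≟_ _ v∈SA) =
    fibre-bound a n pos ms cover J
  m≤k : m ≤ k
  m≤k = ℕ.≤-trans (cover 0ℤ)
          (ℕ.≤-trans (List.length-filter _ (List.allFin k)) (ℕ.≤-reflexive (List.length-tabulate (λ s → s))))
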